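{- Let $n,k$ be nonnegative integers and $s>0$ an integer, and let $r$ be the remainder of $k$ upon division by $s+1$. Then \[ {n+k \brace n}^{(s)}=\sum _{i = 0}^{\min \{\lfloor \frac{n-r}{s+1}\rfloor ,\lfloor \frac{k}{s+1}\rfloor \}}h_{\lfloor \frac{k}{s+1}\rfloor -i}(1^{s+1},2^{s+1},\dots ,n^{s+1})\,{n+1\brack n+1-r-i(s+1)}. \]
   Context: ${n+k \brace n}^{(s)}:=M_{k}^{(s)}(1,2,\dots,n)$, where $M_{k}^{(s)}(x_{1},\ldots,x_{n})=\sum x_{1}^{a_{1}}\cdots x_{n}^{a_{n}}$, the sum over all $n$-tuples of nonnegative integers $(a_1,\dots,a_n)$ with $a_1+\cdots+a_n=k$ and each $a_i\equiv 0$ or $1 \pmod{s+1}$. Here $h_m$ is the complete homogeneous symmetric polynomial of degree $m$ (with $h_0=1$), and ${N \brack j}$ denotes the unsigned Stirling number of the first kind (number of permutations of $[N]$ with $j$ cycles), determined by $x(x+1)\cdots(x+N-1)=\sum_{j=0}^N {N\brack j}x^j$. -}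

module Defs where

open import Data.Nat using (ℕ; zero; suc; _+_; _*_; _∸_; _^_; _%_; _≟_)
open import Data.List using (List; []; _∷_; map; upTo; sum; zipWith; lookup)
open import Data.Bool using (Bool; true; false; if_then_else_; _∨_)
open import Relation.Nullary.Decidable using (⌊_⌋)

sumTo : ℕ → (ℕ → ℕ) → ℕ
sumTo zero    f = f 0
sumTo (suc m) f = sumTo m f + f (suc m)

admissible : ℕ → ℕ → Bool
admissible s a = ⌊ a % suc s ≟ 0 ⌋ ∨ ⌊ a % suc s ≟ 1 ⌋

-- M_k^{(s)}(x_1,...,x_n) = Σ x_1^{a_1}⋯x_n^{a_n} over (a_1,..,a_n) with
-- a_1+⋯+a_n = k and each a_i ≡ 0 or 1 (mod s+1); expanded over the exponent
-- of the first variable.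
M : ℕ → List ℕ → ℕ → ℕ
M s []       k = if ⌊ k ≟ 0 ⌋ then 1 else 0
M s (x ∷ xs) k = sumTo k (λ a → if admissible s a then x ^ a * M s xs (k ∸ a) else 0)

h : List ℕ → ℕ → ℕ
h []       m = if ⌊ m ≟ 0 ⌋ then 1 else 0
h (y ∷ ys) m = sumTo m (λ a → y ^ a * h ys (m ∸ a))

oneTo : ℕ → List ℕ
oneTo n = map suc (upTo n)

stirling2s : ℕ → ℕ → ℕ → ℕ
stirling2s s n k = M s (oneTo n) k

-- polynomials as coefficient lists (constant term first)
polyAdd : List ℕ → List ℕ → List ℕ
polyAdd []       q        = q
polyAdd p        []       = p
polyAdd (a ∷ p)  (b ∷ q)  = a + b ∷ polyAdd p q

mulXplus : ℕ → List ℕ → List ℕ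
mulXplus c p = polyAdd (0 ∷ p) (map (c *_) p)

risingPoly : ℕ → List ℕ
risingPoly zero    = 1 ∷ []
risingPoly (suc N) = mulXplus N (risingPoly N)

coeff : List ℕ → ℕ → ℕ
coeff []      _       = 0
coeff (a ∷ p) zero    = a
coeff (a ∷ p) (suc j) = coeff p j

stirling1 : ℕ → ℕ → ℕ
stirling1 N j = coeff (risingPoly N) j

-- The generating series Σₖ Mₖ tᵏ of M = M^{(s)}(x₁,…,xₙ) factors as ∏ᵢ (1 + xᵢ t) / (1 − xᵢ^q t^q)
-- with q = s + 1, because the admissible exponents a ≡ 0, 1 (mod q) give Σ (x t)ᵃ = (1 + x t) / (1 − (x t)^q).
-- So M is the product of E(t) = ∏ᵢ (1 + xᵢ t), the series of the elementary symmetric polynomials, and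
-- H(t^q), where H is the series of the complete homogeneous polynomials in the xᵢ^q. For k = r + qK only the
-- products e_{r+qi} h_{K−i} contribute, and e_j(1,…,n) = [n+1, n+1−j] since ∏_{i≤n} (1 + i t) is
-- x(x+1)⋯(x+n) with its coefficients reversed. Without division, each factorisation is established by
-- showing both sides solve F = R + w t^q F, an equation with a unique solution.

module Submission where

open import Defs
open import Data.Nat using (ℕ; zero; suc; _+_; _*_; _∸_; _^_; _/_; _%_; _⊓_; _≤_; _<_; z≤n; s≤s; z<s; _<?_; _≤?_; _≟_; NonZero)
open import Data.Nat.Properties
open import Data.Nat.DivMod
open import Data.Nat.Induction using (<-rec)
open import Data.Nat.Tactic.RingSolver using (solve-∀)
open import Data.List using (List; []; _∷_; _∷ʳ_; map; upTo)
import Data.List.Properties as List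
open import Data.Bool using (true; false; if_then_else_; _∨_)
open import Data.Bool.Properties using (if-float)
open import Data.Product using (Σ; _×_; _,_)
open import Data.Sum using (_⊎_; inj₁; inj₂)
open import Relation.Nullary using (yes; no)
open import Relation.Nullary.Decidable using (⌊_⌋)
open import Relation.Binary.PropositionalEquality
  using (_≡_; refl; sym; trans; cong; cong₂; subst; module ≡-Reasoning)

below-or-beyond : ∀ c k → k < c ⊎ Σ ℕ (λ k′ → k ≡ c + k′)
below-or-beyond c k with k <? c
... | yes k<c = inj₁ k<c
... | no  k≮c = inj₂ (k ∸ c , sym (m+[n∸m]≡n (≮⇒≥ k≮c)))

[n+m]%n≡m%n : ∀ m n .{{_ : NonZero n}} → (n + m) % n ≡ m % n
[n+m]%n≡m%n m n = trans (cong (_% n) (+-comm n m)) ([m+n]%n≡m%n m n)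

[n+m]/n≡1+m/n : ∀ m n .{{_ : NonZero n}} → (n + m) / n ≡ suc (m / n)
[n+m]/n≡1+m/n m n = trans (m/n≡1+[m∸n]/n (m≤m+n n m)) (cong (λ z → suc (z / n)) (m+n∸m≡n n m))

m/n<o⇒m<o*n : ∀ m n o .{{_ : NonZero n}} → m / n < o → m < o * n
m/n<o⇒m<o*n m n o m/n<o = begin-strict
  m                    ≡⟨ m≡m%n+[m/n]*n m n ⟩
  m % n + (m / n) * n  <⟨ +-monoˡ-< ((m / n) * n) (m%n<n m n) ⟩
  suc (m / n) * n      ≤⟨ *-monoˡ-≤ n m/n<o ⟩
  o * n                ∎
  where open ≤-Reasoning

sumTo-cong : ∀ k {f g : ℕ → ℕ} → (∀ a → a ≤ k → f a ≡ g a) → sumTo k f ≡ sumTo k g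
sumTo-cong zero    f≗g = f≗g 0 z≤n
sumTo-cong (suc k) f≗g =
  cong₂ _+_ (sumTo-cong k (λ a a≤k → f≗g a (m≤n⇒m≤1+n a≤k))) (f≗g (suc k) ≤-refl)

sumTo-+ : ∀ k (f g : ℕ → ℕ) → sumTo k (λ a → f a + g a) ≡ sumTo k f + sumTo k g
sumTo-+ zero    f g = refl
sumTo-+ (suc k) f g = trans (cong (_+ (f (suc k) + g (suc k))) (sumTo-+ k f g)) (interchange (sumTo k f) (sumTo k g) (f (suc k)) (g (suc k)))
  where
  interchange : ∀ a b c d → (a + b) + (c + d) ≡ (a + c) + (b + d)
  interchange = solve-∀

sumTo-*ˡ : ∀ k c (f : ℕ → ℕ) → sumTo k (λ a → c * f a) ≡ c * sumTo k f
sumTo-*ˡ zero    c f = refl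
sumTo-*ˡ (suc k) c f = trans (cong (_+ c * f (suc k)) (sumTo-*ˡ k c f)) (sym (*-distribˡ-+ c _ _))

sumTo-unfoldˡ : ∀ k (f : ℕ → ℕ) → sumTo (suc k) f ≡ f 0 + sumTo k (λ a → f (suc a))
sumTo-unfoldˡ zero    f = refl
sumTo-unfoldˡ (suc k) f = trans (cong (_+ f (suc (suc k))) (sumTo-unfoldˡ k f)) (+-assoc (f 0) _ _)

sumTo-zeros : ∀ k {f : ℕ → ℕ} → (∀ a → a ≤ k → f a ≡ 0) → sumTo k f ≡ 0
sumTo-zeros zero    f≗0 = f≗0 0 z≤n
sumTo-zeros (suc k) f≗0 =
  cong₂ _+_ (sumTo-zeros k (λ a a≤k → f≗0 a (m≤n⇒m≤1+n a≤k))) (f≗0 (suc k) ≤-refl)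

sumTo-head : ∀ k (f : ℕ → ℕ) → (∀ a → 0 < a → a ≤ k → f a ≡ 0) → sumTo k f ≡ f 0
sumTo-head zero    f tail≗0 = refl
sumTo-head (suc k) f tail≗0 =
  trans (sumTo-unfoldˡ k f)
    (trans (cong (f 0 +_) (sumTo-zeros k (λ a a≤k → tail≗0 (suc a) z<s (s≤s a≤k))))
           (+-identityʳ (f 0)))

sumTo-dropˡ : ∀ c k (f : ℕ → ℕ) → (∀ a → a < c → f a ≡ 0) →
              sumTo (c + k) f ≡ sumTo k (λ a → f (c + a))
sumTo-dropˡ zero    k f init≗0 = refl
sumTo-dropˡ (suc c) k f init≗0 =
  trans (sumTo-unfoldˡ (c + k) f)
    (trans (cong (_+ sumTo (c + k) (λ a → f (suc a))) (init≗0 0 z<s))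
           (sumTo-dropˡ c k (λ a → f (suc a)) (λ a a<c → init≗0 (suc a) (s≤s a<c))))

sumTo-truncate : ∀ d m (f : ℕ → ℕ) → (∀ j → m < j → f j ≡ 0) → sumTo (d + m) f ≡ sumTo m f
sumTo-truncate zero    m f tail≗0 = refl
sumTo-truncate (suc d) m f tail≗0 =
  trans (cong₂ _+_ (sumTo-truncate d m f tail≗0) (tail≗0 _ (s≤s (m≤n+m m d)))) (+-identityʳ _)

sumTo-⊓ : ∀ K L (f : ℕ → ℕ) → (∀ j → L < j → f j ≡ 0) → sumTo K f ≡ sumTo (L ⊓ K) f
sumTo-⊓ K L f tail≗0 with ≤-total K L
... | inj₁ K≤L = cong (λ m → sumTo m f) (sym (m≥n⇒m⊓n≡n K≤L))
... | inj₂ L≤K = begin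
  sumTo K f                ≡⟨ cong (λ m → sumTo m f) (m∸n+n≡m L≤K) ⟨
  sumTo (K ∸ L + L) f      ≡⟨ sumTo-truncate (K ∸ L) L f tail≗0 ⟩
  sumTo L f                ≡⟨ cong (λ m → sumTo m f) (m≤n⇒m⊓n≡m L≤K) ⟨
  sumTo (L ⊓ K) f          ∎
  where open ≡-Reasoning

sumTo-reverse : ∀ k (f : ℕ → ℕ) → sumTo k f ≡ sumTo k (λ i → f (k ∸ i))
sumTo-reverse zero    f = refl
sumTo-reverse (suc k) f =
  trans (cong (_+ f (suc k)) (sumTo-reverse k f))
    (trans (+-comm (sumTo k (λ i → f (k ∸ i))) (f (suc k)))
           (sym (sumTo-unfoldˡ k (λ i → f (suc k ∸ i)))))

-- Formal power series in t with natural coefficients.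
Series : Set
Series = ℕ → ℕ

one : Series
one zero    = 1
one (suc _) = 0

shift : ℕ → Series → Series
shift zero    F k       = F k
shift (suc c) F zero    = 0
shift (suc c) F (suc k) = shift c F k

mul1+ : ℕ → Series → Series
mul1+ x F k = F k + x * shift 1 F k

_⋆_ : Series → Series → Series
(f ⋆ g) k = sumTo k (λ j → f j * g (k ∸ j))

shift-+ : ∀ c (F : Series) k → shift c F (c + k) ≡ F k
shift-+ zero    F k = refl
shift-+ (suc c) F k = shift-+ c F k

shift-< : ∀ c (F : Series) k → k < c → shift c F k ≡ 0
shift-< (suc c) F zero    k<c       = refl
shift-< (suc c) F (suc k) (s≤s k<c) = shift-< c F k k<c

shift-cong : ∀ c {F G : Series} → (∀ j → F j ≡ G j) → ∀ k → shift c F k ≡ shift c G k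
shift-cong zero    F≗G k       = F≗G k
shift-cong (suc c) F≗G zero    = refl
shift-cong (suc c) F≗G (suc k) = shift-cong c F≗G k

shift-cong-≤ : ∀ c (F G : Series) k → (∀ j → j + c ≤ k → F j ≡ G j) → shift c F k ≡ shift c G k
shift-cong-≤ zero    F G k       F≗G = F≗G k (≤-reflexive (+-identityʳ k))
shift-cong-≤ (suc c) F G zero    F≗G = refl
shift-cong-≤ (suc c) F G (suc k) F≗G =
  shift-cong-≤ c F G k (λ j j+c≤k → F≗G j (subst (_≤ suc k) (sym (+-suc j c)) (s≤s j+c≤k)))

mul1+-cong : ∀ x {F G : Series} → (∀ j → F j ≡ G j) → ∀ k → mul1+ x F k ≡ mul1+ x G k
mul1+-cong x F≗G k = cong₂ (λ a b → a + x * b) (F≗G k) (shift-cong 1 F≗G k)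

mul1+-comm : ∀ x y (F : Series) k → mul1+ x (mul1+ y F) k ≡ mul1+ y (mul1+ x F) k
mul1+-comm x y F zero    = comm₀ (F 0) x y
  where
  comm₀ : ∀ a x y → (a + y * 0) + x * 0 ≡ (a + x * 0) + y * 0
  comm₀ = solve-∀
mul1+-comm x y F (suc k) = comm (F (suc k)) (F k) (shift 1 F k) x y
  where
  comm : ∀ a b c x y → (a + y * b) + x * (b + y * c) ≡ (a + x * b) + y * (b + x * c)
  comm = solve-∀

shift-equation-unique : ∀ c w (R F G : Series) →
  (∀ k → F k ≡ R k + w * shift (suc c) F k) →
  (∀ k → G k ≡ R k + w * shift (suc c) G k) → ∀ k → F k ≡ G k
shift-equation-unique c w R F G F-eq G-eq = <-rec _ step
  where
  step : ∀ k → (∀ {j} → j < k → F j ≡ G j) → F k ≡ G k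
  step k earlier = begin
    F k                          ≡⟨ F-eq k ⟩
    R k + w * shift (suc c) F k  ≡⟨ cong (λ z → R k + w * z) (shift-cong-≤ (suc c) F G k
                                      (λ j j+c≤k → earlier (<-≤-trans (m<m+n j z<s) j+c≤k))) ⟩
    R k + w * shift (suc c) G k  ≡⟨ G-eq k ⟨
    G k                          ∎
    where open ≡-Reasoning

⋆-congˡ : ∀ {f f′ : Series} g → (∀ j → f j ≡ f′ j) → ∀ k → (f ⋆ g) k ≡ (f′ ⋆ g) k
⋆-congˡ g f≗f′ k = sumTo-cong k (λ j _ → cong (_* g (k ∸ j)) (f≗f′ j))

⋆-comm : ∀ (f g : Series) k → (f ⋆ g) k ≡ (g ⋆ f) k
⋆-comm f g k = trans (sumTo-reverse k _) (sumTo-cong k λ j j≤k →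
  trans (cong (λ i → f (k ∸ j) * g i) (m∸[m∸n]≡n j≤k)) (*-comm (f (k ∸ j)) (g j)))

one-⋆ : ∀ (g : Series) k → (one ⋆ g) k ≡ g k
one-⋆ g k = trans (sumTo-head k _ (λ { (suc a) _ _ → refl })) (+-identityʳ (g k))

⋆-+ˡ : ∀ (f g : Series) w (h : Series) k → ((λ a → f a + w * g a) ⋆ h) k ≡ (f ⋆ h) k + w * (g ⋆ h) k
⋆-+ˡ f g w h k = begin
  sumTo k (λ a → (f a + w * g a) * h (k ∸ a))
    ≡⟨ sumTo-cong k (λ a _ → distrib (f a) w (g a) (h (k ∸ a))) ⟩
  sumTo k (λ a → f a * h (k ∸ a) + w * (g a * h (k ∸ a)))
    ≡⟨ sumTo-+ k _ _ ⟩
  (f ⋆ h) k + sumTo k (λ a → w * (g a * h (k ∸ a)))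
    ≡⟨ cong ((f ⋆ h) k +_) (sumTo-*ˡ k w _) ⟩
  (f ⋆ h) k + w * (g ⋆ h) k
    ∎
  where
  open ≡-Reasoning
  distrib : ∀ a w b d → (a + w * b) * d ≡ a * d + w * (b * d)
  distrib = solve-∀

shift-⋆ : ∀ c (f g : Series) k → (shift c f ⋆ g) k ≡ shift c (f ⋆ g) k
shift-⋆ c f g k with below-or-beyond c k
... | inj₁ k<c =
  trans (sumTo-zeros k (λ a a≤k → cong (_* g (k ∸ a)) (shift-< c f a (≤-<-trans a≤k k<c))))
        (sym (shift-< c (f ⋆ g) k k<c))
... | inj₂ (k′ , refl) = begin
  (shift c f ⋆ g) (c + k′)
    ≡⟨ sumTo-dropˡ c k′ _ (λ a a<c → cong (_* g (c + k′ ∸ a)) (shift-< c f a a<c)) ⟩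
  sumTo k′ (λ a → shift c f (c + a) * g (c + k′ ∸ (c + a)))
    ≡⟨ sumTo-cong k′ (λ a _ → cong₂ _*_ (shift-+ c f a) (cong g ([m+n]∸[m+o]≡n∸o c k′ a))) ⟩
  (f ⋆ g) k′
    ≡⟨ shift-+ c (f ⋆ g) k′ ⟨
  shift c (f ⋆ g) (c + k′)
    ∎
  where open ≡-Reasoning

⋆-unfold : ∀ c w {f} (g h : Series) → (∀ a → f a ≡ g a + w * shift c f a) →
           ∀ k → (f ⋆ h) k ≡ (g ⋆ h) k + w * shift c (f ⋆ h) k
⋆-unfold c w {f} g h f-eq k =
  trans (⋆-congˡ h f-eq k)
    (trans (⋆-+ˡ g (shift c f) w h k) (cong (λ z → (g ⋆ h) k + w * z) (shift-⋆ c f h k)))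

mul1+-⋆ : ∀ x (f g : Series) k → (mul1+ x f ⋆ g) k ≡ mul1+ x (f ⋆ g) k
mul1+-⋆ x f g k = trans (⋆-+ˡ f (shift 1 f) x g k) (cong (λ z → (f ⋆ g) k + x * z) (shift-⋆ 1 f g k))

module Dilation (p : ℕ) where

  q : ℕ
  q = suc p

  dilate : Series → Series
  dilate g c = if ⌊ c % q ≟ 0 ⌋ then g (c / q) else 0

  dilate-below : ∀ (g : Series) c → 0 < c → c < q → dilate g c ≡ 0
  dilate-below g (suc c) _ c<q = cong (λ r → if ⌊ r ≟ 0 ⌋ then g (suc c / q) else 0) (m<n⇒m%n≡m c<q)

  dilate-step : ∀ (g : Series) c → dilate g (q + c) ≡ dilate (λ m → g (suc m)) c
  dilate-step g c = cong₂ (λ r m → if ⌊ r ≟ 0 ⌋ then g m else 0) ([n+m]%n≡m%n c q) ([n+m]/n≡1+m/n c q)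

  dilate-cong : ∀ {f g : Series} → (∀ m → f m ≡ g m) → ∀ c → dilate f c ≡ dilate g c
  dilate-cong f≗g c = cong (λ z → if ⌊ c % q ≟ 0 ⌋ then z else 0) (f≗g (c / q))

  dilate-+ : ∀ (f g : Series) w c → dilate (λ m → f m + w * g m) c ≡ dilate f c + w * dilate g c
  dilate-+ f g w c with ⌊ c % q ≟ 0 ⌋
  ... | true  = refl
  ... | false = sym (*-zeroʳ w)

  dilate-shift : ∀ (g : Series) c → dilate (shift 1 g) c ≡ shift q (dilate g) c
  dilate-shift g c with below-or-beyond q c
  ... | inj₁ c<q with c
  ...   | zero   = refl
  ...   | suc c′ = trans (dilate-below (shift 1 g) (suc c′) z<s c<q) (sym (shift-< q (dilate g) (suc c′) c<q))
  dilate-shift g c | inj₂ (c′ , refl) = trans (dilate-step (shift 1 g) c′) (sym (shift-+ q (dilate g) c′))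

  sumTo-dilate : ∀ K r (g G : Series) → r < q →
                 sumTo (r + q * K) (λ c → dilate g c * G c) ≡ sumTo K (λ m → g m * G (q * m))
  sumTo-dilate zero r g G r<q = begin
    sumTo (r + q * 0) (λ c → dilate g c * G c)  ≡⟨ cong (λ m → sumTo m (λ c → dilate g c * G c)) r+q*0≡r ⟩
    sumTo r (λ c → dilate g c * G c)            ≡⟨ sumTo-head r _ (λ c 0<c c≤r →
                                                     cong (_* G c) (dilate-below g c 0<c (≤-<-trans c≤r r<q))) ⟩
    g 0 * G 0                                   ≡⟨ cong (λ z → g 0 * G z) (*-zeroʳ q) ⟨
    g 0 * G (q * 0)                             ∎
    where
    open ≡-Reasoning
    r+q*0≡r : r + q * 0 ≡ r
    r+q*0≡r = trans (cong (r +_) (*-zeroʳ q)) (+-identityʳ r)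
  sumTo-dilate (suc K) r g G r<q = begin
    sumTo (r + q * suc K) F
      ≡⟨ cong (λ m → sumTo m F) (regroup r p K) ⟩
    sumTo (suc (p + (r + q * K))) F
      ≡⟨ sumTo-unfoldˡ (p + (r + q * K)) F ⟩
    g 0 * G 0 + sumTo (p + (r + q * K)) (λ c → F (suc c))
      ≡⟨ cong (g 0 * G 0 +_) (sumTo-dropˡ p (r + q * K) _ (λ c c<p →
           cong (_* G (suc c)) (dilate-below g (suc c) z<s (s≤s c<p)))) ⟩
    g 0 * G 0 + sumTo (r + q * K) (λ c → dilate g (q + c) * G (q + c))
      ≡⟨ cong (g 0 * G 0 +_) (sumTo-cong (r + q * K) (λ c _ → cong (_* G (q + c)) (dilate-step g c))) ⟩
    g 0 * G 0 + sumTo (r + q * K) (λ c → dilate (λ m → g (suc m)) c * G (q + c))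
      ≡⟨ cong (g 0 * G 0 +_) (sumTo-dilate K r (λ m → g (suc m)) (λ c → G (q + c)) r<q) ⟩
    g 0 * G 0 + sumTo K (λ m → g (suc m) * G (q + q * m))
      ≡⟨ cong₂ (λ a b → g 0 * G a + b) (*-zeroʳ q)
           (sumTo-cong K (λ m _ → cong (λ z → g (suc m) * G z) (*-suc q m))) ⟨
    g 0 * G (q * 0) + sumTo K (λ m → g (suc m) * G (q * suc m))
      ≡⟨ sumTo-unfoldˡ K (λ m → g m * G (q * m)) ⟨
    sumTo (suc K) (λ m → g m * G (q * m))
      ∎
    where
    open ≡-Reasoning
    F : ℕ → ℕ
    F c = dilate g c * G c
    regroup : ∀ r p K → r + suc p * suc K ≡ suc (p + (r + suc p * K))
    regroup = solve-∀

  dilate-one : ∀ c → dilate one c ≡ one c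
  dilate-one c with below-or-beyond q c
  ... | inj₁ c<q with c
  ...   | zero   = refl
  ...   | suc c′ = dilate-below one (suc c′) z<s c<q
  dilate-one c | inj₂ (c′ , refl) = trans (dilate-step one c′) (dilate-zero c′)
    where
    dilate-zero : ∀ c → dilate (λ _ → 0) c ≡ 0
    dilate-zero c with ⌊ c % q ≟ 0 ⌋
    ... | true  = refl
    ... | false = refl

E : List ℕ → Series
E []       = one
E (x ∷ xs) = mul1+ x (E xs)

E-∷ʳ : ∀ xs y k → E (xs ∷ʳ y) k ≡ mul1+ y (E xs) k
E-∷ʳ []       y k = refl
E-∷ʳ (x ∷ xs) y k = trans (mul1+-cong x (E-∷ʳ xs y) k) (mul1+-comm x y (E xs) k)

oneTo-suc : ∀ n → oneTo (suc n) ≡ oneTo n ∷ʳ suc n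
oneTo-suc n = trans (cong (map suc) (sym (List.upTo-∷ʳ n))) (List.map-++ suc (upTo n) (n ∷ []))

coeff-polyAdd : ∀ p q j → coeff (polyAdd p q) j ≡ coeff p j + coeff q j
coeff-polyAdd []      q       j       = refl
coeff-polyAdd (a ∷ p) []      j       = sym (+-identityʳ _)
coeff-polyAdd (a ∷ p) (b ∷ q) zero    = refl
coeff-polyAdd (a ∷ p) (b ∷ q) (suc j) = coeff-polyAdd p q j

coeff-map-* : ∀ c p j → coeff (map (c *_) p) j ≡ c * coeff p j
coeff-map-* c []      j       = sym (*-zeroʳ c)
coeff-map-* c (a ∷ p) zero    = refl
coeff-map-* c (a ∷ p) (suc j) = coeff-map-* c p j

coeff-mulXplus : ∀ c p j → coeff (mulXplus c p) j ≡ coeff (0 ∷ p) j + c * coeff p j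
coeff-mulXplus c p j = trans (coeff-polyAdd (0 ∷ p) (map (c *_) p) j) (cong (coeff (0 ∷ p) j +_) (coeff-map-* c p j))

stirling1-suc-0 : ∀ N → stirling1 (suc N) 0 ≡ 0
stirling1-suc-0 zero    = refl
stirling1-suc-0 (suc N) =
  trans (coeff-mulXplus (suc N) (risingPoly (suc N)) 0)
        (trans (cong (suc N *_) (stirling1-suc-0 N)) (*-zeroʳ (suc N)))

stirling1-suc-suc : ∀ N j → stirling1 (suc N) (suc j) ≡ stirling1 N j + N * stirling1 N (suc j)
stirling1-suc-suc N j = coeff-mulXplus N (risingPoly N) (suc j)

stirling1-beyond : ∀ N j → N < j → stirling1 N j ≡ 0
stirling1-beyond zero    (suc j) _         = refl
stirling1-beyond (suc N) (suc j) (s≤s N<j) =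
  trans (stirling1-suc-suc N j)
    (trans (cong₂ (λ a b → a + N * b) (stirling1-beyond N j N<j) (stirling1-beyond N (suc j) (m<n⇒m<1+n N<j)))
           (*-zeroʳ N))

reversedStirling1 : ℕ → Series
reversedStirling1 n j = stirling1 (suc n) (suc n ∸ j)

reversedStirling1-suc : ∀ n j → reversedStirling1 (suc n) j ≡ mul1+ (suc n) (reversedStirling1 n) j
reversedStirling1-suc n zero =
  trans (stirling1-suc-suc (suc n) (suc n))
        (cong (λ z → stirling1 (suc n) (suc n) + suc n * z) (stirling1-beyond (suc n) (suc (suc n)) ≤-refl))
reversedStirling1-suc n (suc j) with j ≤? n
... | yes j≤n rewrite +-∸-assoc 1 j≤n = stirling1-suc-suc (suc n) (n ∸ j)
... | no  j≰n rewrite m≤n⇒m∸n≡0 (≰⇒> j≰n) | m≤n⇒m∸n≡0 (<⇒≤ (≰⇒> j≰n)) | stirling1-suc-0 n =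
  trans (stirling1-suc-0 (suc n)) (sym (*-zeroʳ (suc n)))

reversedStirling1-beyond : ∀ n j → n < j → reversedStirling1 n j ≡ 0
reversedStirling1-beyond n j n<j = trans (cong (stirling1 (suc n)) (m≤n⇒m∸n≡0 n<j)) (stirling1-suc-0 n)

E-oneTo : ∀ n j → E (oneTo n) j ≡ reversedStirling1 n j
E-oneTo zero    zero          = refl
E-oneTo zero    (suc zero)    = refl
E-oneTo zero    (suc (suc j)) = refl
E-oneTo (suc n) j = begin
  E (oneTo (suc n)) j                      ≡⟨ cong (λ xs → E xs j) (oneTo-suc n) ⟩
  E (oneTo n ∷ʳ suc n) j                   ≡⟨ E-∷ʳ (oneTo n) (suc n) j ⟩
  mul1+ (suc n) (E (oneTo n)) j            ≡⟨ mul1+-cong (suc n) (E-oneTo n) j ⟩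
  mul1+ (suc n) (reversedStirling1 n) j    ≡⟨ reversedStirling1-suc n j ⟨
  reversedStirling1 (suc n) j              ∎
  where open ≡-Reasoning

geometric-unfold : ∀ y a → y ^ a ≡ one a + y * shift 1 (y ^_) a
geometric-unfold y zero    = sym (cong (1 +_) (*-zeroʳ y))
geometric-unfold y (suc a) = refl

h-unfold : ∀ y ys m → h (y ∷ ys) m ≡ h ys m + y * shift 1 (h (y ∷ ys)) m
h-unfold y ys m =
  trans (⋆-unfold 1 y one (h ys) (geometric-unfold y) m) (cong (_+ y * shift 1 (h (y ∷ ys)) m) (one-⋆ (h ys) m))

module Expansion (t : ℕ) where

  s : ℕ
  s = suc t

  open Dilation s public

  admissibleSeries : ℕ → Series
  admissibleSeries x a = if admissible s a then x ^ a else 0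

  -- Needs q ≥ 2, which keeps the admissible residues 0 and 1 apart.
  admissibleSeries-unfold : ∀ x a → admissibleSeries x a ≡ mul1+ x one a + x ^ q * shift q (admissibleSeries x) a
  admissibleSeries-unfold x a with below-or-beyond q a
  ... | inj₁ a<q with a
  ...   | zero         = sym (cong₂ (λ u v → (1 + u) + v) (*-zeroʳ x) (*-zeroʳ (x ^ q)))
  ...   | suc zero     = sym (trans (cong (x * 1 +_) (*-zeroʳ (x ^ q))) (+-identityʳ (x * 1)))
  ...   | suc (suc a′) = trans
      (cong (λ r → if ⌊ r ≟ 0 ⌋ ∨ ⌊ r ≟ 1 ⌋ then x ^ suc (suc a′) else 0) (m<n⇒m%n≡m a<q))
      (sym (trans (cong₂ (λ u v → u + x ^ q * v) (*-zeroʳ x) (shift-< q _ _ a<q)) (*-zeroʳ (x ^ q))))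
  admissibleSeries-unfold x a | inj₂ (a′ , refl) = begin
    admissibleSeries x (q + a′)
      ≡⟨ cong₂ (λ r e → if ⌊ r ≟ 0 ⌋ ∨ ⌊ r ≟ 1 ⌋ then e else 0) ([n+m]%n≡m%n a′ q) (^-distribˡ-+-* x q a′) ⟩
    (if admissible s a′ then x ^ q * x ^ a′ else 0)
      ≡⟨ factor (admissible s a′) ⟩
    x ^ q * admissibleSeries x a′
      ≡⟨ cong₂ (λ u v → u + x ^ q * v) (*-zeroʳ x) (shift-+ q (admissibleSeries x) a′) ⟨
    mul1+ x one (q + a′) + x ^ q * shift q (admissibleSeries x) (q + a′)
      ∎
    where
    open ≡-Reasoning
    factor : ∀ b → (if b then x ^ q * x ^ a′ else 0) ≡ x ^ q * (if b then x ^ a′ else 0)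
    factor true  = refl
    factor false = sym (*-zeroʳ (x ^ q))

  M-∷ : ∀ x xs k → M s (x ∷ xs) k ≡ (admissibleSeries x ⋆ M s xs) k
  M-∷ x xs k = sumTo-cong k (λ a _ → sym (if-float (_* M s xs (k ∸ a)) (admissible s a)))

  M-unfold : ∀ x xs k → M s (x ∷ xs) k ≡ mul1+ x (M s xs) k + x ^ q * shift q (M s (x ∷ xs)) k
  M-unfold x xs k = begin
    M s (x ∷ xs) k
      ≡⟨ M-∷ x xs k ⟩
    (admissibleSeries x ⋆ M s xs) k
      ≡⟨ ⋆-unfold q (x ^ q) (mul1+ x one) (M s xs) (admissibleSeries-unfold x) k ⟩
    (mul1+ x one ⋆ M s xs) k + x ^ q * shift q (admissibleSeries x ⋆ M s xs) k
      ≡⟨ cong₂ (λ u v → u + x ^ q * v)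
           (trans (mul1+-⋆ x one (M s xs) k) (mul1+-cong x (one-⋆ (M s xs)) k))
           (shift-cong q (λ j → sym (M-∷ x xs j)) k) ⟩
    mul1+ x (M s xs) k + x ^ q * shift q (M s (x ∷ xs)) k
      ∎
    where open ≡-Reasoning

  H : List ℕ → Series
  H xs = h (map (λ x → x ^ q) xs)

  dilateH-unfold : ∀ x xs c → dilate (H (x ∷ xs)) c ≡ dilate (H xs) c + x ^ q * shift q (dilate (H (x ∷ xs))) c
  dilateH-unfold x xs c =
    trans (dilate-cong (h-unfold (x ^ q) (map (λ x → x ^ q) xs)) c)
      (trans (dilate-+ (H xs) (shift 1 (H (x ∷ xs))) (x ^ q) c)
             (cong (λ z → dilate (H xs) c + x ^ q * z) (dilate-shift (H (x ∷ xs)) c)))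

  EH : List ℕ → Series
  EH xs = E xs ⋆ dilate (H xs)

  EH-unfold : ∀ x xs k → EH (x ∷ xs) k ≡ mul1+ x (EH xs) k + x ^ q * shift q (EH (x ∷ xs)) k
  EH-unfold x xs k = begin
    (E (x ∷ xs) ⋆ dilate (H (x ∷ xs))) k
      ≡⟨ ⋆-comm (E (x ∷ xs)) (dilate (H (x ∷ xs))) k ⟩
    (dilate (H (x ∷ xs)) ⋆ E (x ∷ xs)) k
      ≡⟨ ⋆-unfold q (x ^ q) (dilate (H xs)) (E (x ∷ xs)) (dilateH-unfold x xs) k ⟩
    (dilate (H xs) ⋆ E (x ∷ xs)) k + x ^ q * shift q (dilate (H (x ∷ xs)) ⋆ E (x ∷ xs)) k
      ≡⟨ cong₂ (λ u v → u + x ^ q * v)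
           (trans (⋆-comm (dilate (H xs)) (E (x ∷ xs)) k) (mul1+-⋆ x (E xs) (dilate (H xs)) k))
           (shift-cong q (⋆-comm (dilate (H (x ∷ xs))) (E (x ∷ xs))) k) ⟩
    mul1+ x (EH xs) k + x ^ q * shift q (EH (x ∷ xs)) k
      ∎
    where open ≡-Reasoning

  M≡EH : ∀ xs k → M s xs k ≡ EH xs k
  M≡EH [] k = begin
    M s [] k            ≡⟨ M-[] k ⟩
    one k               ≡⟨ dilate-one k ⟨
    dilate one k        ≡⟨ dilate-cong H-[] k ⟨
    dilate (H []) k     ≡⟨ one-⋆ (dilate (H [])) k ⟨
    EH [] k             ∎
    where
    open ≡-Reasoning
    M-[] : ∀ k → M s [] k ≡ one k
    M-[] zero    = refl
    M-[] (suc k) = refl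
    H-[] : ∀ m → H [] m ≡ one m
    H-[] zero    = refl
    H-[] (suc m) = refl
  M≡EH (x ∷ xs) = shift-equation-unique s (x ^ q) (mul1+ x (M s xs)) (M s (x ∷ xs)) (EH (x ∷ xs))
    (M-unfold x xs)
    (λ k → trans (EH-unfold x xs k) (cong (_+ x ^ q * shift q (EH (x ∷ xs)) k) (mul1+-cong x (λ j → sym (M≡EH xs j)) k)))

  EH-at : ∀ xs K r → r < q → EH xs (r + q * K) ≡ sumTo K (λ i → H xs (K ∸ i) * E xs (r + q * i))
  EH-at xs K r r<q = begin
    EH xs k
      ≡⟨ ⋆-comm (E xs) (dilate (H xs)) k ⟩
    sumTo k (λ c → dilate (H xs) c * E xs (k ∸ c))
      ≡⟨ sumTo-dilate K r (H xs) (λ c → E xs (k ∸ c)) r<q ⟩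
    sumTo K (λ m → H xs m * E xs (k ∸ q * m))
      ≡⟨ sumTo-reverse K _ ⟩
    sumTo K (λ i → H xs (K ∸ i) * E xs (k ∸ q * (K ∸ i)))
      ≡⟨ sumTo-cong K (λ i i≤K → cong (λ j → H xs (K ∸ i) * E xs j) (complement i i≤K)) ⟩
    sumTo K (λ i → H xs (K ∸ i) * E xs (r + q * i))
      ∎
    where
    open ≡-Reasoning
    k : ℕ
    k = r + q * K
    complement : ∀ i → i ≤ K → k ∸ q * (K ∸ i) ≡ r + q * i
    complement i i≤K = begin
      r + q * K ∸ q * (K ∸ i)                ≡⟨ cong (λ m → r + q * m ∸ q * (K ∸ i)) (m+[n∸m]≡n i≤K) ⟨
      r + q * (i + (K ∸ i)) ∸ q * (K ∸ i)    ≡⟨ cong (_∸ q * (K ∸ i)) (regroup r q i (K ∸ i)) ⟩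
      r + q * i + q * (K ∸ i) ∸ q * (K ∸ i)  ≡⟨ m+n∸n≡m (r + q * i) (q * (K ∸ i)) ⟩
      r + q * i                              ∎
      where
      regroup : ∀ r q i d → r + q * (i + d) ≡ r + q * i + q * d
      regroup = solve-∀

  stirling2s-expansion : ∀ n K r → r < q →
    stirling2s s n (r + q * K) ≡ sumTo K (λ i → H (oneTo n) (K ∸ i) * reversedStirling1 n (r + q * i))
  stirling2s-expansion n K r r<q =
    trans (M≡EH (oneTo n) (r + q * K))
      (trans (EH-at (oneTo n) K r r<q)
             (sumTo-cong K (λ i _ → cong (H (oneTo n) (K ∸ i) *_) (E-oneTo n (r + q * i)))))

theorem4p2 : (n k s : ℕ) → .{{_ : NonZero s}} →
    ((k % suc s) ≤ n →
      stirling2s s n k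
        ≡ sumTo (((n ∸ k % suc s) / suc s) ⊓ (k / suc s))
            (λ i → h (map (λ x → x ^ suc s) (oneTo n)) (k / suc s ∸ i)
                   * stirling1 (n + 1) (n + 1 ∸ k % suc s ∸ i * suc s)))
    × (n < k % suc s → stirling2s s n k ≡ 0)
theorem4p2 n k zero {{()}}
theorem4p2 n k (suc t) = expansion , vanishing
  where
  open Expansion t
  r K : ℕ
  r = k % q
  K = k / q
  term : ℕ → ℕ
  term i = H (oneTo n) (K ∸ i) * reversedStirling1 n (r + q * i)
  whole : stirling2s s n k ≡ sumTo K term
  whole = trans (cong (stirling2s s n) (trans (m≡m%n+[m/n]*n k q) (cong (r +_) (*-comm K q))))
                (stirling2s-expansion n K r (m%n<n k q))
  term-vanishes : ∀ i → n < r + q * i → term i ≡ 0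
  term-vanishes i n<j =
    trans (cong (H (oneTo n) (K ∸ i) *_) (reversedStirling1-beyond n _ n<j)) (*-zeroʳ (H (oneTo n) (K ∸ i)))
  vanishing : n < r → stirling2s s n k ≡ 0
  vanishing n<r = trans whole (sumTo-zeros K (λ i _ → term-vanishes i (<-≤-trans n<r (m≤m+n r (q * i)))))
  expansion : r ≤ n → stirling2s s n k ≡ sumTo (((n ∸ r) / q) ⊓ K)
                (λ i → H (oneTo n) (K ∸ i) * stirling1 (n + 1) (n + 1 ∸ r ∸ i * q))
  expansion r≤n =
    trans whole (trans (sumTo-⊓ K L term beyond)
                       (sumTo-cong (L ⊓ K) (λ i _ → cong (H (oneTo n) (K ∸ i) *_) (reindex i))))
    where
    L : ℕ
    L = (n ∸ r) / q
    beyond : ∀ i → L < i → term i ≡ 0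
    beyond i lt = term-vanishes i (subst (_< r + q * i) (m+[n∸m]≡n r≤n)
                    (+-monoʳ-< r (subst (n ∸ r <_) (*-comm i q) (m/n<o⇒m<o*n (n ∸ r) q i lt))))
    reindex : ∀ i → reversedStirling1 n (r + q * i) ≡ stirling1 (n + 1) (n + 1 ∸ r ∸ i * q)
    reindex i = cong₂ stirling1 (+-comm 1 n)
      (trans (sym (∸-+-assoc (suc n) r (q * i))) (cong₂ (λ m j → m ∸ r ∸ j) (+-comm 1 n) (*-comm q i)))
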